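{- For every integer $d\ge1$ there exists a subdivision $W$ of $\hat{T}_{2,d}$ with $i_{1,1}(W)\le 2$.
   Context: Discrete-time immunization model with $r=s=1$. For a finite graph $H$, a protocol is a finite sequence $(A_1,\dots,A_N)$ of subsets of $V(H)$ (vertices immunized at time-step $t$); its width is $\max_i|A_i|$. At time $0$ all vertices are red. For $t\ge1$ each vertex is green, yellow or red at time $t$: if $v\in A_t$ then $v$ is green; otherwise, a vertex red or yellow at time $t-1$ is red at time $t$, and a vertex green at time $t-1$ becomes yellow at time $t$ if it has a neighbor that is red at time $t$, and stays green otherwise. The protocol clears $H$ if all vertices are green at time $N$. $i_{1,1}(H)$ is the minimum width of a protocol that clears $H$. $T_{m,d}$ is the complete $m$-ary tree of depth $d$ (a rooted tree in which every non-leaf vertex has exactly $m$ children and all leaves are at depth $d$), and $\hat{T}_{m,d}$ is obtained from $T_{m,d}$ by attaching a new leaf (the stem) to the root. A subdivision of a graph is obtained by replacing edges by paths with new internal vertices. -}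

module Defs where

open import Data.Nat using (ℕ; zero; suc; _^_; _/_; _≤_; _⊔_)
open import Data.Nat.Properties using (≤-<-trans)
open import Data.Nat.DivMod using (m/n≤m)
open import Data.Fin using (Fin; toℕ; fromℕ<)
open import Data.Fin.Properties using (toℕ<n) renaming (_≟_ to _≟F_)
open import Data.Bool using (Bool; true; false; if_then_else_; _∧_; _∨_; not)
open import Data.Bool.ListAction using (any)
open import Data.List using (List; []; _∷_; map; foldl; foldr; length; zip; _++_; concatMap; mapMaybe; lookup; allFin)
open import Data.Maybe using (Maybe; just; nothing)
open import Data.Product using (Σ; _×_; _,_; ∃)
open import Data.Sum using (_⊎_; inj₁; inj₂)
import Data.Sum.Properties as SumP
import Data.Product.Properties as ProdP
open import Relation.Binary using (DecidableEquality)
open import Relation.Nullary.Decidable using (⌊_⌋)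
open import Relation.Binary.PropositionalEquality using (_≡_)

-- Graphs: a vertex type with decidable equality and a list of
-- (undirected) edges; {u,v} is an edge iff (u,v) or (v,u) occurs in E.

record Graph : Set₁ where
  field
    V   : Set
    _≟_ : DecidableEquality V
    E   : List (V × V)

-- The immunization model with r = s = 1.

data Colour : Set where
  green yellow red : Colour

isGreen : Colour → Bool
isGreen green = true
isGreen _     = false

module Dynamics (G : Graph) where
  open Graph G

  Protocol : Set
  Protocol = List (List V)

  width : Protocol → ℕ
  width P = foldr _⊔_ 0 (map length P)

  _∈ᵇ_ : V → List V → Bool
  v ∈ᵇ A = any (λ a → ⌊ a ≟ v ⌋) A

  step : (V → Colour) → List V → (V → Colour)
  step c A v = if v ∈ᵇ A then green else old (c v)
    where
      redNow : V → Bool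
      redNow u = not (u ∈ᵇ A) ∧ not (isGreen (c u))
      hasRedNbr : Bool
      hasRedNbr = any (λ { (x , y) → (⌊ x ≟ v ⌋ ∧ redNow y) ∨ (⌊ y ≟ v ⌋ ∧ redNow x) }) E
      old : Colour → Colour
      old green = if hasRedNbr then yellow else green
      old _     = red

  allRed : V → Colour
  allRed _ = red

  run : Protocol → (V → Colour)
  run P = foldl step allRed P

  Clears : Protocol → Set
  Clears P = ∀ v → run P v ≡ green

  -- i_{1,1}(G) ≤ k  ⇔  some protocol of width ≤ k clears G
  i11≤ : ℕ → Set
  i11≤ k = Σ Protocol (λ P → width P ≤ k × Clears P)

consecutive : {A : Set} → List A → List (A × A)
consecutive []           = []
consecutive (x ∷ [])     = []
consecutive (x ∷ y ∷ xs) = (x , y) ∷ consecutive (y ∷ xs)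

subdivide : (G : Graph) → (Fin (length (Graph.E G)) → ℕ) → Graph
subdivide G ℓ = record
  { V   = V ⊎ Σ (Fin (length E)) (λ j → Fin (ℓ j))
  ; _≟_ = SumP.≡-dec _≟_ (ProdP.≡-dec _≟F_ _≟F_)
  ; E   = concatMap pathEdges (allFin (length E))
  }
  where
    open Graph G
    pathEdges : Fin (length E) → List _
    pathEdges j with lookup E j
    ... | (u , v) = consecutive
          (inj₁ u ∷ (map (λ k → inj₂ (j , k)) (allFin (ℓ j)) ++ (inj₁ v ∷ [])))

-- \hat T_{2,d} in heap numbering: vertices 0 … 2^(d+1)-1; vertex 0 is the
-- stem, vertex 1 is the root, vertex i ≥ 1 is adjacent to ⌊i/2⌋.
-- Vertices 1 … 2^(d+1)-1 form the complete binary tree T_{2,d}.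

parent : ∀ {n} → Fin n → Fin n
parent {n} i = fromℕ< (≤-<-trans (m/n≤m (toℕ i) 2) (toℕ<n i))

upEdge : ∀ {n} → Fin n → Maybe (Fin n × Fin n)
upEdge i with toℕ i
... | zero  = nothing
... | suc _ = just (i , parent i)

That2 : ℕ → Graph
That2 d = record
  { V   = Fin (2 ^ suc d)
  ; _≟_ = _≟F_
  ; E   = mapMaybe upEdge (allFin (2 ^ suc d))
  }

-- A subtree of height h + 1 rooted at x is cleaned recursively: clean the subtree of the left child,
-- sweep the path from that child up to x, clean the subtree of the right child, and sweep both child
-- paths up to x.  A sweep immunizes, at each step, one vertex on each of at most two paths, moving
-- towards x, so every protocol has width at most 2.
-- Correctness is tracked with potentials φ on the subdivided tree that change by at most one along each
-- edge.  If every vertex with φ > m is green, then after any step every vertex with φ > m + 1 is still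
-- green (the infection advances at most one edge per step); if moreover the level set φ = m is
-- immunized, then afterwards every vertex with φ > m - 1 is green.  The edge above a vertex of height h
-- is subdivided into cleanTime h vertices, the length of the protocol cleaning a subtree of height h, so
-- the swept left path is a buffer the infection cannot cross while the right subtree is cleaned.  The
-- whole tree is finally swept into the stem.

module Submission where

open import Defs
open import Data.Nat as ℕ using (ℕ; zero; suc; _+_; _*_; _∸_; _^_; _⊔_; _⊓_; _≤_; _<_; z≤n; s≤s; s≤s⁻¹; ⌊_/2⌋; _/_)
open import Data.Nat.Properties hiding (_≟_)
open import Data.Nat.DivMod using (m/n≡1+[m∸n]/n)
open import Data.Nat.Induction using (<-rec)
open import Data.Nat.Logarithm using (⌊log₂_⌋; ⌊log₂⌊n/2⌋⌋≡⌊log₂n⌋∸1; ⌊log₂⌋-mono-≤)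
open import Data.Bool using (Bool; true; false; T; not; _∧_; _∨_; if_then_else_)
open import Data.Bool.Properties using (T-≡; ∧-zeroʳ)
open import Data.Bool.ListAction using (any)
open import Data.Empty using (⊥-elim)
open import Data.Fin using (Fin; toℕ) renaming (zero to fzero; suc to fsuc)
open import Data.Fin.Properties using (toℕ<n; toℕ-fromℕ<)
open import Data.List using (List; []; _∷_; _++_; map; foldl; length; lookup; tabulate; allFin; applyDownFrom; mapMaybe; catMaybes)
open import Data.List.Properties
  using (map-++; map-∘; map-tabulate; mapMaybe-just; length-++; length-map; length-catMaybes; length-applyDownFrom; foldl-++)
open import Data.List.Membership.Propositional using (_∈_)
open import Data.List.Membership.Propositional.Properties using (∈-concatMap⁻)
open import Data.List.Relation.Unary.All using (All; []; _∷_)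
open import Data.List.Relation.Unary.All.Properties using (++⁺; applyDownFrom⁺₂)
open import Data.List.Relation.Unary.Any as Any using (here; there; satisfied)
open import Data.List.Relation.Unary.Any.Properties using (any⁺; mapMaybe⁺) renaming (map⁺ to Any-map⁺)
open import Data.List.Relation.Unary.Linked using (Linked; []; [-]; _∷_)
open import Data.List.Relation.Unary.Linked.Properties using (map⁻)
open import Data.Maybe as Maybe using (Maybe; just; nothing; _>>=_)
import Data.Maybe.Relation.Unary.Any as MaybeAny
open import Data.Product using (Σ; ∃-syntax; _×_; _,_; proj₁; proj₂)
open import Data.Sum as Sum using (_⊎_; inj₁; inj₂)
open import Function using (Equivalence; _∘_; _∘′_)
open import Relation.Unary using (Decidable)
open import Relation.Nullary using (¬_; ¬?; Dec; yes; no; _×-dec_)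
open import Relation.Nullary.Decidable using (⌊_⌋; fromWitness)
open import Relation.Binary.PropositionalEquality
  using (_≡_; _≢_; refl; sym; trans; cong; cong₂; subst; subst₂; module ≡-Reasoning)

-- Potentials along a subdivided edge

Near : ℕ → ℕ → Set
Near a b = a ≤ suc b × b ≤ suc a

-- The potential i steps along a subdivided edge from its source (potential U) towards its target (potential V).
pathHeight : ℕ → ℕ → ℕ → ℕ
pathHeight U V i = (U ∸ i) ⊔ (U ⊓ V)

pathHeight-source : ∀ U V → pathHeight U V 0 ≡ U
pathHeight-source U V = ⊔-absorbs-⊓ U V

pathHeight-near : ∀ U V i → Near (pathHeight U V i) (pathHeight U V (suc i))
pathHeight-near U V i =
  ⊔-mono-≤ (∸-suc-≤ U i) (n≤1+n (U ⊓ V)) ,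
  ⊔-mono-≤ (≤-trans (∸-monoʳ-≤ U (n≤1+n i)) (n≤1+n (U ∸ i))) (n≤1+n (U ⊓ V))
  where
  ∸-suc-≤ : ∀ a i → a ∸ i ≤ suc (a ∸ suc i)
  ∸-suc-≤ zero    i rewrite 0∸n≡0 i = z≤n
  ∸-suc-≤ (suc a) zero    = ≤-refl
  ∸-suc-≤ (suc a) (suc i) = ∸-suc-≤ a i

pathHeight-target : ∀ {U V n} → V ≤ suc U → U ≤ n + suc V → Near (pathHeight U V n) V
pathHeight-target {U} {V} {n} V≤1+U U≤n+1+V with ≤-total U V
... | inj₁ U≤V rewrite m≤n⇒m⊓n≡m U≤V | m≤n⇒m⊔n≡n (m∸n≤m U n) = ≤-trans U≤V (n≤1+n V) , V≤1+U
... | inj₂ V≤U rewrite m≥n⇒m⊓n≡n V≤U =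
  ⊔-lub (m≤n+o⇒m∸n≤o U n U≤n+1+V) (n≤1+n V) , ≤-trans (m≤n⊔m (U ∸ n) V) (n≤1+n _)

pathHeight-flat : ∀ U i → pathHeight U U i ≡ U
pathHeight-flat U i rewrite ⊓-idem U = m≤n⇒m⊔n≡n (m∸n≤m U i)

pathHeight-slope : ∀ {U i} → i < U → pathHeight U 1 i ≡ U ∸ i
pathHeight-slope {suc U} {i} i<U rewrite ⊓-zeroʳ U = m≥n⇒m⊔n≡m (m<n⇒0<n∸m i<U)

pathHeight-low : ∀ {U V i} → U ≤ 1 → U ⊓ V ≡ 0 → pathHeight U V (suc i) ≡ 0
pathHeight-low {U} {V} {i} U≤1 U⊓V≡0 rewrite U⊓V≡0 | m≤n⇒m∸n≡0 (≤-trans U≤1 (s≤s (z≤n {i}))) = refl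

-- On a path descending from suc L, the vertex k < L sits at height suc L ∸ k.
descent-position : ∀ {L k m} → k < L → suc L ∸ k ≡ suc m → ∃[ m′ ] m ≡ suc m′ × k ≡ L ∸ suc m′
descent-position {L} {k} {m} k<L eq = L ∸ suc k , m≡ , sym k≡
  where
  L∸k≡ : L ∸ k ≡ suc (L ∸ suc k)
  L∸k≡ = +-∸-assoc 1 k<L
  m≡ : m ≡ suc (L ∸ suc k)
  m≡ = trans (sym (suc-injective (trans (sym (+-∸-assoc 1 (<⇒≤ k<L))) eq))) L∸k≡
  k≡ : L ∸ suc (L ∸ suc k) ≡ k
  k≡ = trans (cong (L ∸_) (sym L∸k≡)) (m∸[m∸n]≡n (<⇒≤ k<L))

linked⇒consecutive : ∀ {A : Set} {R : A → A → Set} {xs a b} → Linked R xs → (a , b) ∈ consecutive xs → R a b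
linked⇒consecutive (Rxy ∷ _)   (here refl) = Rxy
linked⇒consecutive (_ ∷ Rxs) (there ab∈) = linked⇒consecutive Rxs ab∈

linked-path : ∀ {n} (s : ℕ → ℕ) {b} → (∀ i → Near (s i) (s (suc i))) → Near (s n) b →
              Linked Near (s 0 ∷ tabulate {n = n} (s ∘ suc ∘ toℕ) ++ b ∷ [])
linked-path {zero}  s steps last = last ∷ [-]
linked-path {suc n} s steps last = steps 0 ∷ linked-path (s ∘ suc) (steps ∘ suc) last

fromℕ? : ∀ {m} → ℕ → Maybe (Fin m)
fromℕ? {zero}  _       = nothing
fromℕ? {suc m} zero    = just fzero
fromℕ? {suc m} (suc t) = Maybe.map fsuc (fromℕ? t)

fromℕ?-toℕ : ∀ {m} (i : Fin m) → fromℕ? (toℕ i) ≡ just i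
fromℕ?-toℕ fzero    = refl
fromℕ?-toℕ (fsuc i) rewrite fromℕ?-toℕ i = refl

∈-mapMaybe : ∀ {A B : Set} {f : A → Maybe B} {a b xs} → a ∈ xs → f a ≡ just b → b ∈ mapMaybe f xs
∈-mapMaybe {f = f} {xs = xs} a∈xs fa≡ =
  mapMaybe⁺ f xs (Any-map⁺ (Any.map (λ { refl → subst (MaybeAny.Any (_ ≡_)) (sym fa≡) (MaybeAny.just refl) }) a∈xs))

mapMaybe-length : ∀ {A B : Set} (f : A → Maybe B) xs → length (mapMaybe f xs) ≤ length xs
mapMaybe-length f xs = ≤-trans (length-catMaybes (map f xs)) (≤-reflexive (length-map f xs))

lookup-tabulate′ : ∀ {A : Set} {n} {xs : List A} {f : Fin n → A} → xs ≡ tabulate f →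
                   (j : Fin (length xs)) → ∃[ i ] toℕ i ≡ toℕ j × lookup xs j ≡ f i
lookup-tabulate′ {n = suc n} refl fzero    = fzero , refl , refl
lookup-tabulate′ {n = suc n} refl (fsuc j) with lookup-tabulate′ refl j
... | i , i≡j , lookup≡ = fsuc i , cong suc i≡j , lookup≡

-- Heap-numbered binary trees

-- x ≼ t: t lies in the subtree rooted at x in heap numbering, where the parent of t is ⌊ t /2⌋
-- and the children of x are x + x and suc (x + x).

infix 4 _≼_ _≼?_

data _≼_ (x : ℕ) : ℕ → Set where
  ≼-refl  : x ≼ x
  ≼-child : ∀ {t} → x ≼ ⌊ t /2⌋ → x ≼ t

≼⇒≤ : ∀ {x t} → x ≼ t → x ≤ t
≼⇒≤ ≼-refl           = ≤-refl
≼⇒≤ (≼-child {t} x≼) = ≤-trans (≼⇒≤ x≼) (⌊n/2⌋≤n t)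

≼-zero : ∀ {x} → x ≼ 0 → x ≡ 0
≼-zero ≼-refl        = refl
≼-zero (≼-child x≼0) = ≼-zero x≼0

≼-top : ∀ {x t} → x ≼ t → ¬ x ≼ ⌊ t /2⌋ → t ≡ x
≼-top ≼-refl        _ = refl
≼-top (≼-child x≼) x⋠ = ⊥-elim (x⋠ x≼)

≼-parent : ∀ {x t} → x ≼ t → t ≢ x → x ≼ ⌊ t /2⌋
≼-parent ≼-refl        t≢x = ⊥-elim (t≢x refl)
≼-parent (≼-child x≼) _   = x≼

_≼?_ : ∀ x t → Dec (x ≼ t)
x ≼? t = <-rec (λ t → Dec (x ≼ t)) decide t
  where
  decide : ∀ t → (∀ {u} → u < t → Dec (x ≼ u)) → Dec (x ≼ t)
  decide t rec with t ℕ.≟ x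
  ... | yes refl = yes ≼-refl
  decide zero    rec | no t≢x = no λ x≼0 → t≢x (sym (≼-zero x≼0))
  decide (suc t) rec | no t≢x with rec (⌊n/2⌋<n t)
  ... | yes x≼ = yes (≼-child x≼)
  ... | no  x⋠ = no λ x≼ → t≢x (≼-top x≼ x⋠)

halve-parity : ∀ t → t ≡ ⌊ t /2⌋ + ⌊ t /2⌋ ⊎ t ≡ suc (⌊ t /2⌋ + ⌊ t /2⌋)
halve-parity zero          = inj₁ refl
halve-parity (suc zero)    = inj₂ refl
halve-parity (suc (suc t)) with halve-parity t
... | inj₁ even = inj₁ (cong suc (trans (cong suc even) (sym (+-suc ⌊ t /2⌋ ⌊ t /2⌋))))
... | inj₂ odd  = inj₂ (cong (suc ∘′ suc) (trans odd (sym (+-suc ⌊ t /2⌋ ⌊ t /2⌋))))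

child-of : ∀ {x t} → ⌊ t /2⌋ ≡ x → t ≡ x + x ⊎ t ≡ suc (x + x)
child-of refl = halve-parity _

half+half≤ : ∀ t → ⌊ t /2⌋ + ⌊ t /2⌋ ≤ t
half+half≤ t with halve-parity t
... | inj₁ even = ≤-reflexive (sym even)
... | inj₂ odd  = ≤-trans (n≤1+n _) (≤-reflexive (sym odd))

≼-split : ∀ {x t} → x ≼ t → t ≢ x → x + x ≼ t ⊎ suc (x + x) ≼ t
≼-split ≼-refl t≢x = ⊥-elim (t≢x refl)
≼-split {x} (≼-child {t} x≼) t≢x with ⌊ t /2⌋ ℕ.≟ x
... | yes parent≡x = Sum.map (λ t≡ → subst (x + x ≼_) (sym t≡) ≼-refl)
                              (λ t≡ → subst (suc (x + x) ≼_) (sym t≡) ≼-refl) (child-of parent≡x)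
... | no  parent≢x = Sum.map ≼-child ≼-child (≼-split x≼ parent≢x)

≼-strict⇒double≤ : ∀ {x t} → x ≼ t → t ≢ x → x + x ≤ t
≼-strict⇒double≤ x≼t t≢x with ≼-split x≼t t≢x
... | inj₁ left  = ≼⇒≤ left
... | inj₂ right = ≤-trans (n≤1+n _) (≼⇒≤ right)

1≼n : ∀ {n} → 1 ≤ n → 1 ≼ n
1≼n {n} = <-rec (λ t → 1 ≤ t → 1 ≼ t) below n
  where
  below : ∀ t → (∀ {u} → u < t → 1 ≤ u → 1 ≼ u) → 1 ≤ t → 1 ≼ t
  below (suc zero)    _   _ = ≼-refl
  below (suc (suc t)) rec _ = ≼-child (rec (⌊n/2⌋<n (suc t)) (s≤s z≤n))

depth-child : ∀ {t} → 2 ≤ t → ⌊log₂ t ⌋ ≡ suc ⌊log₂ ⌊ t /2⌋ ⌋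
depth-child {t} 2≤t =
  trans (sym (m+[n∸m]≡n (⌊log₂⌋-mono-≤ {2} {t} 2≤t))) (cong suc (sym (⌊log₂⌊n/2⌋⌋≡⌊log₂n⌋∸1 t)))

2^⌊log₂n⌋≤n : ∀ {n} → 1 ≤ n → 2 ^ ⌊log₂ n ⌋ ≤ n
2^⌊log₂n⌋≤n {n} = <-rec (λ n → 1 ≤ n → 2 ^ ⌊log₂ n ⌋ ≤ n) below n
  where
  below : ∀ n → (∀ {m} → m < n → 1 ≤ m → 2 ^ ⌊log₂ m ⌋ ≤ m) → 1 ≤ n → 2 ^ ⌊log₂ n ⌋ ≤ n
  below (suc zero)    _   _ = ≤-refl
  below (suc (suc n)) rec _ = begin
    2 ^ ⌊log₂ suc (suc n) ⌋        ≡⟨ cong (2 ^_) (depth-child {suc (suc n)} (s≤s (s≤s z≤n))) ⟩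
    2 * 2 ^ ⌊log₂ h ⌋              ≤⟨ *-monoʳ-≤ 2 (rec (⌊n/2⌋<n (suc n)) (s≤s z≤n)) ⟩
    2 * h                          ≡⟨ cong (h +_) (+-identityʳ h) ⟩
    h + h                          ≤⟨ half+half≤ (suc (suc n)) ⟩
    suc (suc n)                    ∎
    where
    open ≤-Reasoning
    h = ⌊ suc (suc n) /2⌋

n/2≡⌊n/2⌋ : ∀ n → n / 2 ≡ ⌊ n /2⌋
n/2≡⌊n/2⌋ zero          = refl
n/2≡⌊n/2⌋ (suc zero)    = refl
n/2≡⌊n/2⌋ (suc (suc n)) = trans (m/n≡1+[m∸n]/n {suc (suc n)} {2} (s≤s (s≤s z≤n))) (cong suc (n/2≡⌊n/2⌋ n))

toℕ-parent : ∀ {n} (i : Fin n) → toℕ (parent i) ≡ ⌊ toℕ i /2⌋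
toℕ-parent i = trans (toℕ-fromℕ< _) (n/2≡⌊n/2⌋ (toℕ i))

upEdges : ∀ M → mapMaybe upEdge (allFin (suc M)) ≡ tabulate (λ (i : Fin M) → fsuc i , parent (fsuc i))
upEdges M = trans (cong catMaybes (map-tabulate fsuc upEdge))
                  (trans (cong catMaybes (sym (map-tabulate edge just))) (mapMaybe-just (tabulate edge)))
  where
  edge : Fin M → Fin (suc M) × Fin (suc M)
  edge i = fsuc i , parent (fsuc i)

upEdge-lookup : ∀ N (j : Fin (length (mapMaybe upEdge (allFin N)))) →
                toℕ (proj₁ (lookup (mapMaybe upEdge (allFin N)) j)) ≡ suc (toℕ j) ×
                proj₂ (lookup (mapMaybe upEdge (allFin N)) j) ≡ parent (proj₁ (lookup (mapMaybe upEdge (allFin N)) j))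
upEdge-lookup (suc M) j with lookup-tabulate′ (upEdges M) j
... | i , i≡j , lookup≡ rewrite lookup≡ = cong suc i≡j , refl

⌊t/2⌋<t : ∀ {t} → 1 ≤ t → ⌊ t /2⌋ < t
⌊t/2⌋<t {suc t} _ = ⌊n/2⌋<n t

depth-of-child : ∀ {x t} → 1 ≤ x → ⌊ t /2⌋ ≡ x → ⌊log₂ t ⌋ ≡ suc ⌊log₂ x ⌋
depth-of-child {x} {t} 1≤x parent≡x =
  trans (depth-child 2≤t) (cong (suc ∘′ ⌊log₂_⌋) parent≡x)
  where
  2≤x+x : 2 ≤ x + x
  2≤x+x = +-mono-≤ 1≤x 1≤x
  2≤t : 2 ≤ t
  2≤t with child-of parent≡x
  ... | inj₁ t≡ = subst (2 ≤_) (sym t≡) 2≤x+x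
  ... | inj₂ t≡ = subst (2 ≤_) (sym t≡) (≤-trans 2≤x+x (n≤1+n _))

-- The immunization dynamics

module Immunization (H : Graph) where
  open Graph H
  open Dynamics H

  Adjacent : V → V → Set
  Adjacent u v = (u , v) ∈ E ⊎ (v , u) ∈ E

  -- u cannot be a red neighbour of anybody during the step that immunizes A
  Shielded : (V → Colour) → List V → V → Set
  Shielded c A u = T (u ∈ᵇ A) ⊎ c u ≡ green

  ∈⇒∈ᵇ : ∀ {v A} → v ∈ A → T (v ∈ᵇ A)
  ∈⇒∈ᵇ v∈A = any⁺ _ (Any.map (λ { refl → fromWitness refl }) v∈A)

  step-immunized : ∀ c A {v} → T (v ∈ᵇ A) → step c A v ≡ green
  step-immunized c A {v} v∈A rewrite Equivalence.to T-≡ v∈A = refl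

  -- the local predicate redNow of Dynamics.step
  redNow : (V → Colour) → List V → V → Bool
  redNow c A u = not (u ∈ᵇ A) ∧ not (isGreen (c u))

  private
    shielded⇒¬red : ∀ {c A u} → Shielded c A u → redNow c A u ≡ false
    shielded⇒¬red {A = A} {u} (inj₁ u∈A) rewrite Equivalence.to T-≡ u∈A = refl
    shielded⇒¬red {c} {A} {u} (inj₂ green-u) rewrite green-u = ∧-zeroʳ (not (u ∈ᵇ A))

    any-false : ∀ {X : Set} (p : X → Bool) xs → (∀ {x} → x ∈ xs → p x ≡ false) → any p xs ≡ false
    any-false p []       _     = refl
    any-false p (x ∷ xs) px≡false rewrite px≡false (here refl) = any-false p xs (λ x∈ → px≡false (there x∈))

  step-stays-green : ∀ c A {v} → c v ≡ green → (∀ {u} → Adjacent v u → Shielded c A u) →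
                     step c A v ≡ green
  step-stays-green c A {v} green-v shielded with v ∈ᵇ A
  ... | true  = refl
  ... | false rewrite green-v =
    no-red-neighbour (any-false _ E λ {(x , y)} e →
      edge-harmless x y e (redNow c A) λ {u} adj → shielded⇒¬red {c} {A} {u} (shielded adj))
    where
    no-red-neighbour : ∀ {b} → b ≡ false → (if b then yellow else green) ≡ green
    no-red-neighbour refl = refl
    edge-harmless : ∀ x y → (x , y) ∈ E → (isRed : V → Bool) → (∀ {u} → Adjacent v u → isRed u ≡ false) →
                    ((⌊ x ≟ v ⌋ ∧ isRed y) ∨ (⌊ y ≟ v ⌋ ∧ isRed x)) ≡ false
    edge-harmless x y e isRed harmless with x ≟ v | y ≟ v
    ... | yes refl | yes refl rewrite harmless (inj₁ e) = refl
    ... | yes refl | no _     rewrite harmless (inj₁ e) = refl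
    ... | no _     | yes refl rewrite harmless (inj₂ e) = refl
    ... | no _     | no _     = refl

  Lipschitz : (V → ℕ) → Set
  Lipschitz φ = ∀ {u v} → (u , v) ∈ E → Near (φ u) (φ v)

  GreenAbove : (V → ℕ) → ℕ → (V → Colour) → Set
  GreenAbove φ m c = ∀ v → m < φ v → c v ≡ green

  GreenAbove-weaken : ∀ {φ m m′ c} → m ≤ m′ → GreenAbove φ m c → GreenAbove φ m′ c
  GreenAbove-weaken m≤m′ ok v m′<φv = ok v (≤-<-trans m≤m′ m′<φv)

  runFrom : (V → Colour) → Protocol → (V → Colour)
  runFrom = foldl step

  module _ {φ : V → ℕ} (lip : Lipschitz φ) where

    private
      adjacent-≤ : ∀ {v u} → Adjacent v u → φ v ≤ suc (φ u)
      adjacent-≤ (inj₁ e) = proj₁ (lip e)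
      adjacent-≤ (inj₂ e) = proj₂ (lip e)

    green-erodes : ∀ {m c} A → GreenAbove φ m c → GreenAbove φ (suc m) (step c A)
    green-erodes {m} {c} A ok v m+1<φv =
      step-stays-green c A (ok v (<-trans (n<1+n m) m+1<φv))
        λ adj → inj₂ (ok _ (s≤s⁻¹ (<-≤-trans m+1<φv (adjacent-≤ adj))))

    green-erodes* : ∀ {m c} P → GreenAbove φ m c → GreenAbove φ (length P + m) (runFrom c P)
    green-erodes* []          ok = ok
    green-erodes* {m} {c} (A ∷ P) ok =
      subst (λ k → GreenAbove φ k (runFrom (step c A) P)) (+-suc (length P) m) (green-erodes* P (green-erodes A ok))

    green-descends : ∀ {m c A} → (∀ v → φ v ≡ suc m → T (v ∈ᵇ A)) →
                     GreenAbove φ (suc m) c → GreenAbove φ m (step c A)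
    green-descends {m} {c} {A} level⊆A ok v m<φv with φ v ℕ.≟ suc m
    ... | yes φv≡m+1 = step-immunized c A (level⊆A v φv≡m+1)
    ... | no  φv≢m+1 = step-stays-green c A (ok v (above m<φv φv≢m+1)) shielded
      where
      above : ∀ {k} → m < k → k ≢ suc m → suc m < k
      above m<k k≢ = ≤∧≢⇒< m<k (λ eq → k≢ (sym eq))
      shielded : ∀ {u} → Adjacent v u → Shielded c A u
      shielded {u} adj with φ u ℕ.≟ suc m
      ... | yes φu≡m+1 = inj₁ (level⊆A u φu≡m+1)
      ... | no  φu≢m+1 =
        inj₂ (ok u (above (s≤s⁻¹ (<-≤-trans (above m<φv φv≢m+1) (adjacent-≤ adj))) φu≢m+1))

    green-descends* : ∀ {M c} (A : ℕ → List V) → (∀ m → m < M → ∀ v → φ v ≡ suc m → T (v ∈ᵇ A m)) →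
                      GreenAbove φ M c → GreenAbove φ 0 (runFrom c (applyDownFrom A M))
    green-descends* {zero}  A levels ok = ok
    green-descends* {suc M} A levels ok =
      green-descends* A (λ m m<M → levels m (m<n⇒m<1+n m<M))
        (green-descends (levels M (n<1+n M)) ok)

  width-≤ : ∀ {k} P → All (λ A → length A ≤ k) P → width P ≤ k
  width-≤ []      []        = z≤n
  width-≤ (A ∷ P) (A≤ ∷ P≤) = ⊔-lub A≤ (width-≤ P P≤)

-- Subdivisions

module Subdivision (G : Graph) (ℓ : Fin (length (Graph.E G)) → ℕ) where
  open Graph G

  W : Graph
  W = subdivide G ℓ

  source target : Fin (length E) → V
  source j = proj₁ (lookup E j)
  target j = proj₂ (lookup E j)

  pathVia : Fin (length E) → V × V → List (Graph.V W)
  pathVia j e = inj₁ (proj₁ e) ∷ map (λ k → inj₂ (j , k)) (allFin (ℓ j)) ++ inj₁ (proj₂ e) ∷ []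

  path : Fin (length E) → List (Graph.V W)
  path j = pathVia j (lookup E j)

  -- subdivide builds the path of edge j by matching on lookup E j, hence the detour through pathVia
  edge-on-path : ∀ {a b} → (a , b) ∈ Graph.E W → ∃[ j ] (a , b) ∈ consecutive (path j)
  edge-on-path {a} {b} ab∈ with satisfied (∈-concatMap⁻ _ {xs = allFin (length E)} ab∈)
  ... | j , ab∈j with lookup E j in eq
  ... | u , v = j , subst (λ e → (a , b) ∈ consecutive (pathVia j e)) (sym eq) ab∈j

  extend : (V → ℕ) → Graph.V W → ℕ
  extend Φ (inj₁ v)       = Φ v
  extend Φ (inj₂ (j , k)) = pathHeight (Φ (source j)) (Φ (target j)) (suc (toℕ k))

  Fits : (V → ℕ) → Set
  Fits Φ = ∀ j → Φ (target j) ≤ suc (Φ (source j)) × Φ (source j) ≤ ℓ j + suc (Φ (target j))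

  module _ {Φ : V → ℕ} (fits : Fits Φ) where

    private
      heights-linked : ∀ j → Linked Near (map (extend Φ) (path j))
      heights-linked j = subst (Linked Near) (sym heights)
        (subst (λ a → Linked Near (a ∷ tabulate (pathHeight hₛ hₜ ∘ suc ∘ toℕ) ++ hₜ ∷ []))
          (pathHeight-source hₛ hₜ)
          (linked-path {ℓ j} (pathHeight hₛ hₜ) (pathHeight-near hₛ hₜ)
            (pathHeight-target (proj₁ (fits j)) (proj₂ (fits j)))))
        where
        hₛ hₜ : ℕ
        hₛ = Φ (source j)
        hₜ = Φ (target j)
        heights : map (extend Φ) (path j) ≡ hₛ ∷ tabulate (pathHeight hₛ hₜ ∘ suc ∘ toℕ) ++ hₜ ∷ []
        heights = cong (hₛ ∷_) (trans (map-++ (extend Φ) (map _ (allFin (ℓ j))) _)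
                    (cong (_++ hₜ ∷ []) (trans (sym (map-∘ (allFin (ℓ j)))) (map-tabulate (λ k → k) _))))

    extend-lipschitz : ∀ {a b} → (a , b) ∈ Graph.E W → Near (extend Φ a) (extend Φ b)
    extend-lipschitz ab∈ with edge-on-path ab∈
    ... | j , ab∈j = linked⇒consecutive (map⁻ (heights-linked j)) ab∈j

-- Cleaning the subdivided tree

cleanTime : ℕ → ℕ
cleanTime zero    = 1
cleanTime (suc h) = cleanTime h + (suc (cleanTime h) + (cleanTime h + suc (cleanTime h)))

module Construction (d : ℕ) where

  n : ℕ
  n = 2 ^ suc d

  -- the number of new vertices on the edge from t to its parent: the time needed to clean the subtree of t
  edgeLength : ℕ → ℕ
  edgeLength t = cleanTime (d ∸ ⌊log₂ t ⌋)

  ℓ : Fin (length (Graph.E (That2 d))) → ℕ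
  ℓ j = edgeLength (suc (toℕ j))

  open Subdivision (That2 d) ℓ public
  open Immunization W public
  open Dynamics W using (Protocol; _∈ᵇ_; step; allRed; Clears) public

  source-index : ∀ j → toℕ (source j) ≡ suc (toℕ j)
  source-index j = proj₁ (upEdge-lookup n j)

  target-parent : ∀ j → toℕ (target j) ≡ ⌊ toℕ (source j) /2⌋
  target-parent j = trans (cong toℕ (proj₂ (upEdge-lookup n j))) (toℕ-parent (source j))

  ℓ≡edgeLength : ∀ j → ℓ j ≡ edgeLength (toℕ (source j))
  ℓ≡edgeLength j = cong edgeLength (sym (source-index j))

  source-pos : ∀ j → 1 ≤ toℕ (source j)
  source-pos j = subst (1 ≤_) (sym (source-index j)) (s≤s z≤n)

  target<source : ∀ j → toℕ (target j) < toℕ (source j)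
  target<source j with toℕ (source j) | target-parent j | source-pos j
  ... | suc s | p≡ | _ = subst (_< suc s) (sym p≡) (⌊n/2⌋<n s)

  vertexAt : ℕ → Maybe (Graph.V W)
  vertexAt t = Maybe.map inj₁ (fromℕ? t)

  -- the vertex at distance k from the lower end of the path above the tree vertex c
  pathVertexAt : ℕ → ℕ → Maybe (Graph.V W)
  pathVertexAt c k = fromℕ? (ℕ.pred c) >>= λ j → Maybe.map (λ k′ → inj₂ (j , k′)) (fromℕ? k)

  vertexAt-toℕ : ∀ t → vertexAt (toℕ t) ≡ just (inj₁ t)
  vertexAt-toℕ t rewrite fromℕ?-toℕ t = refl

  pathVertexAt-toℕ : ∀ j k → pathVertexAt (toℕ (source j)) (toℕ k) ≡ just (inj₂ (j , k))
  pathVertexAt-toℕ j k rewrite source-index j | fromℕ?-toℕ j | fromℕ?-toℕ k = refl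

  InRegion : (ℕ → Set) → Graph.V W → Set
  InRegion R (inj₁ t)       = R (toℕ t)
  InRegion R (inj₂ (j , _)) = R (toℕ (target j))

  RegionGreen : (ℕ → Set) → (Graph.V W → Colour) → Set
  RegionGreen R c = ∀ v → InRegion R v → c v ≡ green

  -- R is the part of the tree already cleaned; the sweep extends it to x through the paths to the vertices cs
  record SweepShape (R : ℕ → Set) (x L : ℕ) (cs : List ℕ) : Set where
    field
      x∉R      : ¬ R x
      closed   : ∀ {t} → 1 ≤ t → R ⌊ t /2⌋ → R t
      frontier : ∀ {t} → 1 ≤ t → R t → ¬ R ⌊ t /2⌋ → ⌊ t /2⌋ ≡ x × t ∈ cs × edgeLength t ≡ L

  sweepStep : ℕ → ℕ → List ℕ → ℕ → List (Graph.V W)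
  sweepStep x L cs zero    = mapMaybe vertexAt (x ∷ [])
  sweepStep x L cs (suc m) = mapMaybe (λ c → pathVertexAt c (L ∸ suc m)) cs

  sweep : ℕ → ℕ → List ℕ → Protocol
  sweep x L cs = applyDownFrom (sweepStep x L cs) (suc L)

  module Sweep {R : ℕ → Set} (R? : Decidable R) {x L cs} (shape : SweepShape R x L cs) where
    open SweepShape shape

    -- Extended to the paths, this is L + 2 on R, descends by one per vertex along each path from a
    -- vertex of cs to x, and is 0 elsewhere; the sweep immunizes its levels L + 1, …, 1 in turn.
    height : ℕ → ℕ
    height t with R? t | t ℕ.≟ x
    ... | yes _ | _     = suc (suc L)
    ... | no _  | yes _ = 1
    ... | no _  | no _  = 0

    Φ : Fin n → ℕ
    Φ t = height (toℕ t)

    height-in : ∀ {t} → R t → height t ≡ suc (suc L)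
    height-in {t} r with R? t
    ... | yes _ = refl
    ... | no ¬r = ⊥-elim (¬r r)

    height-x : ∀ {t} → ¬ R t → t ≡ x → height t ≡ 1
    height-x {t} ¬r t≡x with R? t | t ℕ.≟ x
    ... | yes r | _       = ⊥-elim (¬r r)
    ... | no _  | yes _   = refl
    ... | no _  | no t≢x = ⊥-elim (t≢x t≡x)

    height-out : ∀ {t} → ¬ R t → t ≢ x → height t ≡ 0
    height-out {t} ¬r t≢x with R? t | t ℕ.≟ x
    ... | yes r | _       = ⊥-elim (¬r r)
    ... | no _  | yes t≡x = ⊥-elim (t≢x t≡x)
    ... | no _  | no _    = refl

    vertex-cases : ∀ t → R t ⊎ ¬ R t × t ≡ x ⊎ ¬ R t × t ≢ x
    vertex-cases t with R? t | t ℕ.≟ x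
    ... | yes r | _       = inj₁ r
    ... | no ¬r | yes t≡x = inj₂ (inj₁ (¬r , t≡x))
    ... | no ¬r | no t≢x  = inj₂ (inj₂ (¬r , t≢x))

    height-≤1 : ∀ {t} → ¬ R t → height t ≤ 1
    height-≤1 {t} ¬r with vertex-cases t
    ... | inj₁ r                = ⊥-elim (¬r r)
    ... | inj₂ (inj₁ (_ , t≡x)) = ≤-reflexive (height-x ¬r t≡x)
    ... | inj₂ (inj₂ (_ , t≢x)) = ≤-trans (≤-reflexive (height-out ¬r t≢x)) z≤n

    closed-edge : ∀ j → R (toℕ (target j)) → R (toℕ (source j))
    closed-edge j r = closed (source-pos j) (subst R (target-parent j) r)

    frontier-edge : ∀ j → R (toℕ (source j)) → ¬ R (toℕ (target j)) →
                    toℕ (target j) ≡ x × toℕ (source j) ∈ cs × ℓ j ≡ L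
    frontier-edge j r ¬r with frontier (source-pos j) r (λ r′ → ¬r (subst R (sym (target-parent j)) r′))
    ... | p≡x , s∈cs , length≡ = trans (target-parent j) p≡x , s∈cs , trans (ℓ≡edgeLength j) length≡

    edge-cases : ∀ j → R (toℕ (target j)) ⊎ R (toℕ (source j)) × ¬ R (toℕ (target j)) ⊎ ¬ R (toℕ (source j))
    edge-cases j with R? (toℕ (target j)) | R? (toℕ (source j))
    ... | yes r | _     = inj₁ r
    ... | no ¬r | yes r = inj₂ (inj₁ (r , ¬r))
    ... | no _  | no ¬r = inj₂ (inj₂ ¬r)

    path-inside : ∀ j k → R (toℕ (target j)) → extend Φ (inj₂ (j , k)) ≡ suc (suc L)
    path-inside j k r =
      trans (cong₂ (λ a b → pathHeight a b (suc (toℕ k))) (height-in (closed-edge j r)) (height-in r))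
            (pathHeight-flat (suc (suc L)) (suc (toℕ k)))

    path-frontier : ∀ j k → R (toℕ (source j)) → ¬ R (toℕ (target j)) →
                    toℕ k < L × extend Φ (inj₂ (j , k)) ≡ suc L ∸ toℕ k
    path-frontier j k r ¬r with frontier-edge j r ¬r
    ... | p≡x , _ , ℓ≡L = k<L ,
      trans (cong₂ (λ a b → pathHeight a b (suc (toℕ k))) (height-in r) (height-x ¬r p≡x))
            (pathHeight-slope (s≤s (≤-trans k<L (n≤1+n L))))
      where
      k<L : toℕ k < L
      k<L = subst (toℕ k <_) ℓ≡L (toℕ<n k)

    path-outside : ∀ j k → ¬ R (toℕ (source j)) → extend Φ (inj₂ (j , k)) ≡ 0
    path-outside j k ¬r with vertex-cases (toℕ (source j))
    ... | inj₁ r                = ⊥-elim (¬r r)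
    ... | inj₂ (inj₂ (_ , s≢x)) = pathHeight-low (height-≤1 ¬r) (cong (_⊓ Φ (target j)) (height-out ¬r s≢x))
    ... | inj₂ (inj₁ (_ , s≡x)) =
      pathHeight-low (height-≤1 ¬r) (trans (cong (Φ (source j) ⊓_) target-height) (⊓-zeroʳ _))
      where
      target-height : Φ (target j) ≡ 0
      target-height = height-out (λ r → ¬r (closed-edge j r))
                        λ p≡x → <-irrefl (trans p≡x (sym s≡x)) (target<source j)

    fits : Fits Φ
    fits j with edge-cases j
    ... | inj₁ r = subst₂ Fit (sym (height-in r)) (sym (height-in (closed-edge j r)))
                          (n≤1+n _ , ≤-trans (n≤1+n _) (m≤n+m _ (ℓ j)))
      where Fit = λ a b → a ≤ suc b × b ≤ ℓ j + suc a
    ... | inj₂ (inj₁ (r , ¬r)) with frontier-edge j r ¬r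
    ...   | p≡x , _ , ℓ≡L rewrite height-x ¬r p≡x | height-in r | ℓ≡L = s≤s z≤n , ≤-reflexive (+-comm 2 L)
    fits j | inj₂ (inj₂ ¬r) =
      ≤-trans (height-≤1 (λ r → ¬r (closed-edge j r))) (s≤s z≤n) ,
      ≤-trans (height-≤1 ¬r) (≤-trans (s≤s z≤n) (m≤n+m _ (ℓ j)))

    lipschitz : Lipschitz (extend Φ)
    lipschitz = extend-lipschitz fits

    private
      level-tree : ∀ {m} t → m < suc L → Φ t ≡ suc m → m ≡ 0 × toℕ t ≡ x
      level-tree {m} t m<L+1 eq with vertex-cases (toℕ t)
      ... | inj₁ r                = ⊥-elim (<-irrefl (suc-injective (trans (sym eq) (height-in r))) m<L+1)
      ... | inj₂ (inj₁ (¬r , t≡x)) = suc-injective (trans (sym eq) (height-x ¬r t≡x)) , t≡x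
      ... | inj₂ (inj₂ (¬r , t≢x)) = ⊥-elim (0≢1+n (trans (sym (height-out ¬r t≢x)) eq))

      level-path : ∀ {m} j k → m < suc L → extend Φ (inj₂ (j , k)) ≡ suc m →
                   toℕ (source j) ∈ cs × ∃[ m′ ] m ≡ suc m′ × toℕ k ≡ L ∸ suc m′
      level-path {m} j k m<L+1 eq with edge-cases j
      ... | inj₁ r = ⊥-elim (<-irrefl (suc-injective (trans (sym eq) (path-inside j k r))) m<L+1)
      ... | inj₂ (inj₂ ¬r) = ⊥-elim (0≢1+n (trans (sym (path-outside j k ¬r)) eq))
      ... | inj₂ (inj₁ (r , ¬r)) with path-frontier j k r ¬r
      ...   | k<L , height≡ = proj₁ (proj₂ (frontier-edge j r ¬r)) , descent-position k<L (trans (sym height≡) eq)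

      level⊆sweepStep : ∀ m → m < suc L → ∀ v → extend Φ v ≡ suc m → T (v ∈ᵇ sweepStep x L cs m)
      level⊆sweepStep m m<L+1 (inj₁ t) eq with level-tree t m<L+1 eq
      ... | refl , t≡x = ∈⇒∈ᵇ (∈-mapMaybe {f = vertexAt} {xs = x ∷ []} (here t≡x) (vertexAt-toℕ t))
      level⊆sweepStep m m<L+1 (inj₂ (j , k)) eq with level-path j k m<L+1 eq
      ... | s∈cs , m′ , refl , k≡ =
        ∈⇒∈ᵇ (∈-mapMaybe {f = λ c → pathVertexAt c (L ∸ suc m′)} s∈cs
               (trans (cong (pathVertexAt (toℕ (source j))) (sym k≡)) (pathVertexAt-toℕ j k)))

    sweep-clears : ∀ {c} → GreenAbove (extend Φ) (suc L) c → GreenAbove (extend Φ) 0 (runFrom c (sweep x L cs))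
    sweep-clears = green-descends* lipschitz (sweepStep x L cs) level⊆sweepStep

    region⇒above : ∀ {c} → RegionGreen R c → GreenAbove (extend Φ) (suc L) c
    region⇒above ok (inj₁ t) high with vertex-cases (toℕ t)
    ... | inj₁ r                 = ok (inj₁ t) r
    ... | inj₂ (inj₁ (¬r , _))   = ⊥-elim (<⇒≱ high (≤-trans (height-≤1 ¬r) (s≤s z≤n)))
    ... | inj₂ (inj₂ (¬r , _))   = ⊥-elim (<⇒≱ high (≤-trans (height-≤1 ¬r) (s≤s z≤n)))
    region⇒above ok (inj₂ (j , k)) high with edge-cases j
    ... | inj₁ r               = ok (inj₂ (j , k)) r
    ... | inj₂ (inj₁ (r , ¬r)) =
      ⊥-elim (<⇒≱ high (≤-trans (≤-reflexive (proj₂ (path-frontier j k r ¬r))) (m∸n≤m (suc L) (toℕ k))))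
    ... | inj₂ (inj₂ ¬r)       = ⊥-elim (<⇒≱ high (≤-trans (≤-reflexive (path-outside j k ¬r)) z≤n))

    above⇒region : ∀ {c} → GreenAbove (extend Φ) (suc L) c → RegionGreen R c
    above⇒region ok (inj₁ t)       r = ok (inj₁ t) (≤-reflexive (sym (height-in r)))
    above⇒region ok (inj₂ (j , k)) r = ok (inj₂ (j , k)) (≤-reflexive (sym (path-inside j k r)))

    swept-tree : ∀ {c} → GreenAbove (extend Φ) 0 c → ∀ t → R (toℕ t) ⊎ toℕ t ≡ x → c (inj₁ t) ≡ green
    swept-tree ok t (inj₁ r)   = ok (inj₁ t) (≤-trans (s≤s z≤n) (≤-reflexive (sym (height-in r))))
    swept-tree ok t (inj₂ t≡x) = ok (inj₁ t) (≤-reflexive (sym (height-x (λ r → x∉R (subst R t≡x r)) t≡x)))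

    swept-path : ∀ {c} → GreenAbove (extend Φ) 0 c → ∀ j k → R (toℕ (source j)) → c (inj₂ (j , k)) ≡ green
    swept-path ok j k r with edge-cases j
    ... | inj₁ r′               = ok (inj₂ (j , k)) (≤-trans (s≤s z≤n) (≤-reflexive (sym (path-inside j k r′))))
    ... | inj₂ (inj₂ ¬r)        = ⊥-elim (¬r r)
    ... | inj₂ (inj₁ (_ , ¬r′)) with path-frontier j k r ¬r′
    ...   | k<L , height≡ = ok (inj₂ (j , k)) (subst (0 <_) (sym height≡) (m<n⇒0<n∸m (≤-trans k<L (n≤1+n L))))

  Strict : ℕ → ℕ → Set
  Strict x t = x ≼ t × t ≢ x

  strict? : ∀ x → Decidable (Strict x)
  strict? x t = (x ≼? t) ×-dec (¬? (t ℕ.≟ x))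

  edgeLength-child : ∀ {x t h} → 1 ≤ x → ⌊ t /2⌋ ≡ x → ⌊log₂ x ⌋ + suc h ≡ d → edgeLength t ≡ cleanTime h
  edgeLength-child {x} {t} {h} 1≤x parent≡x depth≡ = cong cleanTime (begin
    d ∸ ⌊log₂ t ⌋                      ≡⟨ cong₂ _∸_ (sym depth≡) (depth-of-child 1≤x parent≡x) ⟩
    ⌊log₂ x ⌋ + suc h ∸ suc ⌊log₂ x ⌋  ≡⟨ cong (_∸ suc ⌊log₂ x ⌋) (+-suc ⌊log₂ x ⌋ h) ⟩
    ⌊log₂ x ⌋ + h ∸ ⌊log₂ x ⌋          ≡⟨ m+n∸m≡n ⌊log₂ x ⌋ h ⟩
    h                                  ∎)
    where open ≡-Reasoning

  subtree-shape : ∀ {c x L} → 1 ≤ c → ⌊ c /2⌋ ≡ x → edgeLength c ≡ L → SweepShape (c ≼_) x L (c ∷ [])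
  subtree-shape {c} {x} {L} 1≤c parent≡x length≡ = record
    { x∉R      = λ c≼x → <⇒≱ (subst (_< c) parent≡x (⌊t/2⌋<t 1≤c)) (≼⇒≤ c≼x)
    ; closed   = λ _ → ≼-child
    ; frontier = frontier
    }
    where
    frontier : ∀ {t} → 1 ≤ t → c ≼ t → ¬ c ≼ ⌊ t /2⌋ → ⌊ t /2⌋ ≡ x × t ∈ c ∷ [] × edgeLength t ≡ L
    frontier _ c≼t c⋠parent with ≼-top c≼t c⋠parent
    ... | refl = parent≡x , here refl , length≡

  strict-shape : ∀ {x h} → 1 ≤ x → ⌊log₂ x ⌋ + suc h ≡ d →
                 SweepShape (Strict x) x (cleanTime h) (x + x ∷ suc (x + x) ∷ [])
  strict-shape {x} {h} 1≤x depth≡ = record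
    { x∉R      = λ (_ , x≢x) → x≢x refl
    ; closed   = λ 1≤t (x≼parent , _) → ≼-child x≼parent , λ { refl → <⇒≱ (⌊t/2⌋<t 1≤t) (≼⇒≤ x≼parent) }
    ; frontier = frontier
    }
    where
    frontier : ∀ {t} → 1 ≤ t → Strict x t → ¬ Strict x ⌊ t /2⌋ →
               ⌊ t /2⌋ ≡ x × t ∈ x + x ∷ suc (x + x) ∷ [] × edgeLength t ≡ cleanTime h
    frontier {t} _ (x≼t , t≢x) not-strict with ⌊ t /2⌋ ℕ.≟ x
    ... | no  parent≢x = ⊥-elim (not-strict (≼-parent x≼t t≢x , parent≢x))
    ... | yes parent≡x = parent≡x , is-child (child-of parent≡x) , edgeLength-child 1≤x parent≡x depth≡
      where
      is-child : t ≡ x + x ⊎ t ≡ suc (x + x) → t ∈ x + x ∷ suc (x + x) ∷ []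
      is-child (inj₁ t≡) = here t≡
      is-child (inj₂ t≡) = there (here t≡)

  clean : ℕ → ℕ → Protocol
  clean zero    x = mapMaybe vertexAt (x ∷ []) ∷ []
  clean (suc h) x = clean h (x + x) ++ sweep x (cleanTime h) (x + x ∷ [])
                 ++ clean h (suc (x + x)) ++ sweep x (cleanTime h) (x + x ∷ suc (x + x) ∷ [])

  sweep-length : ∀ x L cs → length (sweep x L cs) ≡ suc L
  sweep-length x L cs = length-applyDownFrom (sweepStep x L cs) (suc L)

  clean-length : ∀ h x → length (clean h x) ≡ cleanTime h
  clean-length zero    x = refl
  clean-length (suc h) x =
    trans (length-++ (clean h (x + x))) (cong₂ _+_ (clean-length h (x + x))
    (trans (length-++ (sweep x L (x + x ∷ []))) (cong₂ _+_ (sweep-length x L _)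
    (trans (length-++ (clean h (suc (x + x)))) (cong₂ _+_ (clean-length h (suc (x + x))) (sweep-length x L _))))))
    where
    L = cleanTime h

  below-target : ∀ {x} j → x ≼ toℕ (target j) → Strict x (toℕ (source j))
  below-target {x} j x≼p =
    ≼-child (subst (x ≼_) (target-parent j) x≼p) ,
    λ s≡x → <⇒≱ (subst (toℕ (target j) <_) s≡x (target<source j)) (≼⇒≤ x≼p)

  beyond-leaf : ∀ {x t} → 1 ≤ x → ⌊log₂ x ⌋ ≡ d → x + x ≤ t → ¬ t < n
  beyond-leaf {x} {t} 1≤x depth≡ x+x≤t t<n = <⇒≱ t<n (begin
    2 ^ suc d              ≡⟨ cong (λ k → 2 * 2 ^ k) (sym depth≡) ⟩
    2 * 2 ^ ⌊log₂ x ⌋      ≤⟨ *-monoʳ-≤ 2 (2^⌊log₂n⌋≤n 1≤x) ⟩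
    2 * x                  ≡⟨ cong (x +_) (+-identityʳ x) ⟩
    x + x                  ≤⟨ x+x≤t ⟩
    t                      ∎)
    where open ≤-Reasoning

  leaf-greens : ∀ {x} → 1 ≤ x → ⌊log₂ x ⌋ ≡ d → ∀ c → RegionGreen (x ≼_) (step c (mapMaybe vertexAt (x ∷ [])))
  leaf-greens {x} 1≤x depth≡ c (inj₁ t) x≼t with toℕ t ℕ.≟ x
  ... | yes t≡x = step-immunized c _ (∈⇒∈ᵇ (∈-mapMaybe {f = vertexAt} {xs = x ∷ []} (here t≡x) (vertexAt-toℕ t)))
  ... | no  t≢x = ⊥-elim (beyond-leaf 1≤x depth≡ (≼-strict⇒double≤ x≼t t≢x) (toℕ<n t))
  leaf-greens {x} 1≤x depth≡ c (inj₂ (j , k)) x≼p with below-target j x≼p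
  ... | x≼s , s≢x = ⊥-elim (beyond-leaf 1≤x depth≡ (≼-strict⇒double≤ x≼s s≢x) (toℕ<n (source j)))

  RegionGreen-∪ : ∀ {P Q S c} → (∀ {t} → S t → P t ⊎ Q t) → RegionGreen P c → RegionGreen Q c → RegionGreen S c
  RegionGreen-∪ split okP okQ (inj₁ t) s with split s
  ... | inj₁ p = okP (inj₁ t) p
  ... | inj₂ q = okQ (inj₁ t) q
  RegionGreen-∪ split okP okQ (inj₂ e) s with split s
  ... | inj₁ p = okP (inj₂ e) p
  ... | inj₂ q = okQ (inj₂ e) q

  child-depth : ∀ {x t h} → 1 ≤ x → ⌊log₂ x ⌋ + suc h ≡ d → ⌊ t /2⌋ ≡ x → ⌊log₂ t ⌋ + h ≡ d
  child-depth {h = h} 1≤x depth≡ parent≡x =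
    trans (cong (_+ h) (depth-of-child 1≤x parent≡x)) (trans (sym (+-suc _ h)) depth≡)

  swept-subtree : ∀ {x L cs c} (shape : SweepShape (Strict x) x L cs) →
                  GreenAbove (extend (Sweep.Φ (strict? x) shape)) 0 c → RegionGreen (x ≼_) c
  swept-subtree {x} shape ok (inj₁ t) x≼t with toℕ t ℕ.≟ x
  ... | yes t≡x = Sweep.swept-tree (strict? x) shape ok t (inj₂ t≡x)
  ... | no  t≢x = Sweep.swept-tree (strict? x) shape ok t (inj₁ (x≼t , t≢x))
  swept-subtree {x} shape ok (inj₂ (j , k)) x≼p = Sweep.swept-path (strict? x) shape ok j k (below-target j x≼p)

  clean-greens : ∀ h {x} → 1 ≤ x → ⌊log₂ x ⌋ + h ≡ d → ∀ c → RegionGreen (x ≼_) (runFrom c (clean h x))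
  clean-greens zero    {x} 1≤x depth≡ c = leaf-greens 1≤x (trans (sym (+-identityʳ _)) depth≡) c
  clean-greens (suc h) {x} 1≤x depth≡ c =
    subst (RegionGreen (x ≼_)) (sym runs) (swept-subtree shape₂ (S₂.sweep-clears (S₂.region⇒above below-x-green)))
    where
    L = cleanTime h
    c₁ = x + x
    c₂ = suc (x + x)
    c₁-parent : ⌊ c₁ /2⌋ ≡ x
    c₁-parent = sym (n≡⌊n+n/2⌋ x)
    1≤c₁ : 1 ≤ c₁
    1≤c₁ = ≤-trans 1≤x (m≤m+n x x)

    shape₁ = subtree-shape 1≤c₁ c₁-parent (edgeLength-child 1≤x c₁-parent depth≡)
    shape₂ = strict-shape 1≤x depth≡
    module S₁ = Sweep (c₁ ≼?_) shape₁
    module S₂ = Sweep (strict? x) shape₂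

    s₁ = runFrom c (clean h c₁)
    s₂ = runFrom s₁ (sweep x L (c₁ ∷ []))
    s₃ = runFrom s₂ (clean h c₂)

    runs : runFrom c (clean (suc h) x) ≡ runFrom s₃ (sweep x L (c₁ ∷ c₂ ∷ []))
    runs = trans (foldl-++ step c (clean h c₁) _) (trans (foldl-++ step s₁ (sweep x L (c₁ ∷ [])) _)
                 (foldl-++ step s₂ (clean h c₂) _))

    left-swept : GreenAbove (extend S₁.Φ) 0 s₂
    left-swept = S₁.sweep-clears (S₁.region⇒above (clean-greens h 1≤c₁ (child-depth 1≤x depth≡ c₁-parent) c))

    -- the swept path from c₁ to x is long enough to guard the subtree of c₁ while that of c₂ is cleaned
    left-guarded : RegionGreen (c₁ ≼_) s₃
    left-guarded = S₁.above⇒region (GreenAbove-weaken duration≤ (green-erodes* S₁.lipschitz (clean h c₂) left-swept))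
      where
      duration≤ : length (clean h c₂) + 0 ≤ suc L
      duration≤ = ≤-trans (≤-reflexive (trans (+-identityʳ _) (clean-length h c₂))) (n≤1+n L)

    right-green : RegionGreen (c₂ ≼_) s₃
    right-green = clean-greens h (s≤s z≤n) (child-depth 1≤x depth≡ (sym (n≡⌈n+n/2⌉ x))) s₂

    below-x-green : RegionGreen (Strict x) s₃
    below-x-green = RegionGreen-∪ (λ (x≼t , t≢x) → ≼-split x≼t t≢x) left-guarded right-green

  protocol : Protocol
  protocol = clean d 1 ++ sweep 0 (cleanTime d) (1 ∷ [])

  protocol-clears : Clears protocol
  protocol-clears v = subst (λ c → c v ≡ green) (sym (foldl-++ step allRed (clean d 1) _))
                        (all-green v (S.sweep-clears (S.region⇒above (clean-greens d (s≤s z≤n) refl allRed))))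
    where
    module S = Sweep (1 ≼?_) (subtree-shape (s≤s z≤n) refl refl)
    all-green : ∀ v {c} → GreenAbove (extend S.Φ) 0 c → c v ≡ green
    all-green (inj₁ t) ok with toℕ t in t≡
    ... | zero  = S.swept-tree ok t (inj₂ t≡)
    ... | suc _ = S.swept-tree ok t (inj₁ (1≼n (subst (1 ≤_) (sym t≡) (s≤s z≤n))))
    all-green (inj₂ (j , k)) ok = S.swept-path ok j k (1≼n (source-pos j))

  Narrow : Protocol → Set
  Narrow = All (λ A → length A ≤ 2)

  sweep-narrow : ∀ x L {cs} → length cs ≤ 2 → Narrow (sweep x L cs)
  sweep-narrow x L {cs} cs≤2 = applyDownFrom⁺₂ _ (suc L) narrow-step
    where
    narrow-step : ∀ m → length (sweepStep x L cs m) ≤ 2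
    narrow-step zero    = ≤-trans (mapMaybe-length vertexAt (x ∷ [])) (s≤s z≤n)
    narrow-step (suc m) = ≤-trans (mapMaybe-length _ cs) cs≤2

  clean-narrow : ∀ h x → Narrow (clean h x)
  clean-narrow zero    x = ≤-trans (mapMaybe-length vertexAt (x ∷ [])) (s≤s z≤n) ∷ []
  clean-narrow (suc h) x =
    ++⁺ (clean-narrow h (x + x)) (++⁺ (sweep-narrow x (cleanTime h) {x + x ∷ []} (s≤s z≤n))
      (++⁺ (clean-narrow h (suc (x + x))) (sweep-narrow x (cleanTime h) {x + x ∷ suc (x + x) ∷ []} ≤-refl)))

  protocol-narrow : Narrow protocol
  protocol-narrow = ++⁺ (clean-narrow d 1) (sweep-narrow 0 (cleanTime d) {1 ∷ []} (s≤s z≤n))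

theorem5p3 : (d : ℕ) → 1 ≤ d →
    Σ (Fin (length (Graph.E (That2 d))) → ℕ)
      (λ ℓ → Dynamics.i11≤ (subdivide (That2 d) ℓ) 2)
theorem5p3 d _ = ℓ , protocol , width-≤ protocol protocol-narrow , protocol-clears
  where open Construction d
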